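{- Let $p,q,r$ be integers, each $\ge 3$, pairwise coprime, $\theta=\{p,q,r\}$, and \[ Q_\theta(z)=\frac{(z^{pqr}-1)(z^{p}-1)(z^{q}-1)(z^{r}-1)}{(z^{qr}-1)(z^{rp}-1)(z^{pq}-1)(z-1)} \] (a polynomial). For every integer $m$ let $a_m$ be the coefficient of $z^m$ in $Q_\theta$ (so $a_m=0$ if $m<0$ or $m>\deg Q_\theta$). Then $|a_m-a_{m-1}|\le 1$ for all integers $m$. -}

module Defs where

open import Data.Nat as ℕ using (ℕ; zero; suc; _*_; _∸_; _≤?_)
open import Data.Integer as ℤ using (ℤ; +_; -[1+_]; _+_; -_; _-_)
open import Relation.Nullary using (yes; no)

Series : Set
Series = ℕ → ℤ

one : Series
one zero    = + 1
one (suc _) = + 0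

-- Coefficient of zⁿ in zᵏ · f  (zero if n < k).
shift : ℕ → Series → Series
shift k f n with k ≤? n
... | yes _ = f (n ∸ k)
... | no  _ = + 0

mulZk-1 : ℕ → Series → Series
mulZk-1 k f n = shift k f n - f n

geomSum : ℕ → Series → ℕ → ℕ → ℤ
geomSum k f n zero    = shift 0 f n
geomSum k f n (suc j) = shift (suc j * k) f n + geomSum k f n j

-- Division by (zᵏ − 1) in the power-series ring ℤ[[z]], for k ≥ 1:
-- 1/(zᵏ − 1) = − Σ_{j≥0} z^{j k}.
divZk-1 : ℕ → Series → Series
divZk-1 k f n = - geomSum k f n n

-- Coefficients of
--   Q_θ(z) = (z^{pqr}−1)(z^p−1)(z^q−1)(z^r−1)
--            / ((z^{qr}−1)(z^{rp}−1)(z^{pq}−1)(z−1)),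
-- computed as the quotient in ℤ[[z]] (the denominator has constant term 1).
-- Since Q_θ is a polynomial, this is its coefficient sequence.
Qcoeff : ℕ → ℕ → ℕ → Series
Qcoeff p q r =
  divZk-1 1 (divZk-1 (p * q) (divZk-1 (r * p) (divZk-1 (q * r)
    (mulZk-1 r (mulZk-1 q (mulZk-1 p (mulZk-1 (p * q * r) one)))))))

a : ℕ → ℕ → ℕ → ℤ → ℤ
a p q r (+ n)    = Qcoeff p q r n
a p q r -[1+ n ] = + 0

module Submission where

-- Every integer m has a unique representation
--   m = x·qr + y·rp + v·pq + u·pqr,   0 ≤ x < p, 0 ≤ y < q, 0 ≤ v < r, u ∈ ℤ,
-- because p, q, r are pairwise coprime.  Let Δₖ G (m) = G (m − k) − G (m), the
-- coefficient form of multiplication by zᵏ − 1, and δ the impulse at 0.  The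
-- ramp F (m) = max (u + 1, 0) is a Green function of the denominator:
-- Δ_{qr} Δ_{rp} Δ_{pq} F = Δ_{pqr} δ.  Hence H = Δ_r Δ_q Δ_p F solves the
-- difference equation of (z − 1)·Q_θ, and as the quotient in ℤ[[z]] is unique,
-- a(m − 1) − a(m) = H (m).  Finally H (m) is the alternating sum of F over
-- the vertices m − Σ S, S ⊆ {p, q, r}; walking along this cube changes the
-- digits of m by subtraction with borrow, so H (m) is a third difference of
-- ramps whose offsets depend only on three borrow patterns, and a finite
-- check over these patterns gives |H (m)| ≤ 1.  The Green-function identity
-- is established by the same kind of finite check.

open import Defs
open import Data.Bool using (Bool; true; false; T; not; _∧_; _∨_; if_then_else_)
open import Data.Product using (Σ; _×_; _,_; proj₁; proj₂)
open import Data.Empty using (⊥-elim)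
open import Data.List using (List; []; _∷_; foldr; foldl)
open import Data.Bool.ListAction using (all)
open import Data.List.Relation.Unary.All using (All; []; _∷_)
open import Data.List.Relation.Unary.All.Properties using (all⁺)
open import Function using (_∘_)
open import Data.Nat as ℕ using (ℕ; zero; suc; _∸_; _≤_; _<_; _≤?_; z≤n; s≤s; NonZero)
import Data.Nat.Properties as ℕP
open import Data.Nat.Induction using (<-rec)
open import Data.Nat.Coprimality using (Coprime; coprime-Bézout; coprime-divisor)
  renaming (sym to coprime-sym)
open import Data.Nat.Divisibility using (_∣_; divides; ∣⇒≤)
open import Data.Nat.GCD using (module Bézout)
open import Data.Integer as ℤ using (ℤ; +_; -[1+_]; _+_; -_; _-_; _*_; ∣_∣)
import Data.Integer.Properties as ℤP
open import Data.Integer.DivMod using (_/ℕ_; _%ℕ_; a≡a%ℕn+[a/ℕn]*n; n%ℕd<d)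
open import Data.Integer.Tactic.RingSolver using (solve-∀)
open import Relation.Binary.PropositionalEquality
open import Relation.Nullary using (yes; no)
open import Relation.Nullary.Reflects using (Reflects; ofʸ; ofⁿ)
open import Relation.Nullary.Decidable using (isYes; toWitness)
open ≡-Reasoning

infix 4 _≐_
_≐_ : Series → Series → Set
f ≐ g = ∀ n → f n ≡ g n

minus-cancelˡ : ∀ a {b c} → a - b ≡ a - c → b ≡ c
minus-cancelˡ a {b} {c} eq = begin
  b           ≡⟨ twice-negated a b ⟩
  a - (a - b) ≡⟨ cong (λ t → a - t) eq ⟩
  a - (a - c) ≡⟨ twice-negated a c ⟨
  c           ∎
  where
  twice-negated : ∀ a b → b ≡ a - (a - b)
  twice-negated = solve-∀

shift-cong : ∀ k {f g} → f ≐ g → shift k f ≐ shift k g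
shift-cong k eq n with k ≤? n
... | yes _ = eq (n ∸ k)
... | no  _ = refl

mulZk-1-cong : ∀ k {f g} → f ≐ g → mulZk-1 k f ≐ mulZk-1 k g
mulZk-1-cong k eq n = cong₂ _-_ (shift-cong k eq n) (eq n)

shift-below : ∀ k f {n} → n < k → shift k f n ≡ + 0
shift-below k f {n} n<k with k ≤? n
... | yes k≤n = ⊥-elim (ℕP.<⇒≱ n<k k≤n)
... | no  _   = refl

shift-above : ∀ k f {n} → k ≤ n → shift k f n ≡ f (n ∸ k)
shift-above k f {n} k≤n with k ≤? n
... | yes _   = refl
... | no  k≰n = ⊥-elim (k≰n k≤n)

-- For k ≥ 1, multiplication by zᵏ − 1 is injective: the coefficient of zⁿ
-- in f is determined by that of (zᵏ − 1)·f and by a smaller coefficient of f.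
mulZk-1-cancel : ∀ k {f g} → 1 ≤ k → mulZk-1 k f ≐ mulZk-1 k g → f ≐ g
mulZk-1-cancel k {f} {g} 1≤k eq = <-rec (λ n → f n ≡ g n) step
  where
  step : ∀ n → (∀ {m} → m < n → f m ≡ g m) → f n ≡ g n
  step n ih with k ≤? n
  ... | yes k≤n = minus-cancelˡ (g (n ∸ k)) (begin
    g (n ∸ k) - f n   ≡⟨ cong (_- f n) (ih (ℕP.∸-monoʳ-< 1≤k k≤n)) ⟨
    f (n ∸ k) - f n   ≡⟨ cong (_- f n) (shift-above k f k≤n) ⟨
    shift k f n - f n ≡⟨ eq n ⟩
    shift k g n - g n ≡⟨ cong (_- g n) (shift-above k g k≤n) ⟩
    g (n ∸ k) - g n   ∎)
  ... | no  k≰n = minus-cancelˡ (+ 0) (begin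
    + 0 - f n         ≡⟨ cong (_- f n) (shift-below k f (ℕP.≰⇒> k≰n)) ⟨
    shift k f n - f n ≡⟨ eq n ⟩
    shift k g n - g n ≡⟨ cong (_- g n) (shift-below k g (ℕP.≰⇒> k≰n)) ⟩
    + 0 - g n         ∎)

geomSum-below : ∀ k f {n} → n < k → ∀ j → geomSum k f n j ≡ f n
geomSum-below k f n<k zero    = refl
geomSum-below k f {n} n<k (suc j) = begin
  shift (suc j ℕ.* k) f n + geomSum k f n j
    ≡⟨ cong₂ _+_ (shift-below _ f (ℕP.<-≤-trans n<k (ℕP.m≤m+n k (j ℕ.* k))))
                 (geomSum-below k f n<k j) ⟩
  + 0 + f n
    ≡⟨ ℤP.+-identityˡ (f n) ⟩
  f n ∎

geomSum-stable : ∀ k f n → 1 ≤ k → ∀ d → geomSum k f n (d ℕ.+ n) ≡ geomSum k f n n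
geomSum-stable k f n 1≤k zero    = refl
geomSum-stable k f n 1≤k (suc d) = begin
  shift (suc (d ℕ.+ n) ℕ.* k) f n + geomSum k f n (d ℕ.+ n)
    ≡⟨ cong₂ _+_ (shift-below _ f n<) (geomSum-stable k f n 1≤k d) ⟩
  + 0 + geomSum k f n n
    ≡⟨ ℤP.+-identityˡ _ ⟩
  geomSum k f n n ∎
  where
  n< : n < suc (d ℕ.+ n) ℕ.* k
  n< = ℕP.<-≤-trans (s≤s (ℕP.m≤n+m n d))
         (ℕP.≤-trans (ℕP.≤-reflexive (sym (ℕP.*-identityʳ _))) (ℕP.*-monoʳ-≤ (suc (d ℕ.+ n)) 1≤k))

geomSum-step : ∀ k f {n} → k ≤ n → ∀ j → geomSum k f n (suc j) ≡ f n + geomSum k f (n ∸ k) j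
geomSum-step k f {n} k≤n zero = begin
  shift (k ℕ.+ 0) f n + f n ≡⟨ cong (λ e → shift e f n + f n) (ℕP.+-identityʳ k) ⟩
  shift k f n + f n         ≡⟨ cong (_+ f n) (shift-above k f k≤n) ⟩
  f (n ∸ k) + f n           ≡⟨ ℤP.+-comm (f (n ∸ k)) (f n) ⟩
  f n + f (n ∸ k)           ∎
geomSum-step k f {n} k≤n (suc j) = begin
  shift (k ℕ.+ suc j ℕ.* k) f n + geomSum k f n (suc j)
    ≡⟨ cong₂ _+_ (shift-split (suc j ℕ.* k)) (geomSum-step k f k≤n j) ⟩
  shift (suc j ℕ.* k) f (n ∸ k) + (f n + geomSum k f (n ∸ k) j)
    ≡⟨ exchange (shift (suc j ℕ.* k) f (n ∸ k)) (f n) _ ⟩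
  f n + (shift (suc j ℕ.* k) f (n ∸ k) + geomSum k f (n ∸ k) j) ∎
  where
  exchange : ∀ a b c → a + (b + c) ≡ b + (a + c)
  exchange = solve-∀
  shift-split : ∀ e → shift (k ℕ.+ e) f n ≡ shift e f (n ∸ k)
  shift-split e with (k ℕ.+ e) ≤? n | e ≤? (n ∸ k)
  ... | yes _   | yes _  = cong f (sym (ℕP.∸-+-assoc n k e))
  ... | yes k+e≤n | no e≰ = ⊥-elim (e≰ (ℕP.≤-trans (ℕP.≤-reflexive (sym (ℕP.m+n∸m≡n k e))) (ℕP.∸-monoˡ-≤ k k+e≤n)))
  ... | no k+e≰ | yes e≤ = ⊥-elim (k+e≰ (ℕP.≤-trans (ℕP.+-monoʳ-≤ k e≤) (ℕP.≤-reflexive (ℕP.m+[n∸m]≡n k≤n))))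
  ... | no _    | no _   = refl

mulZk-1-divZk-1 : ∀ k f → 1 ≤ k → mulZk-1 k (divZk-1 k f) ≐ f
mulZk-1-divZk-1 k f 1≤k n with n ℕ.<? k
... | yes n<k = begin
  shift k (divZk-1 k f) n + - - geomSum k f n n ≡⟨ cong₂ _+_ (shift-below k _ n<k) (ℤP.neg-involutive _) ⟩
  + 0 + geomSum k f n n                         ≡⟨ ℤP.+-identityˡ _ ⟩
  geomSum k f n n                               ≡⟨ geomSum-below k f n<k n ⟩
  f n                                           ∎
mulZk-1-divZk-1 k f 1≤k zero    | no 0≮k = ⊥-elim (0≮k 1≤k)
mulZk-1-divZk-1 k f 1≤k (suc n) | no n≮k = begin
  shift k (divZk-1 k f) (suc n) - - geomSum k f (suc n) (suc n)
    ≡⟨ cong₂ _-_ (shift-above k _ k≤1+n) (cong -_ (geomSum-step k f k≤1+n n)) ⟩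
  - G - - (f (suc n) + geomSum k f m n)
    ≡⟨ cong (λ t → - G - - (f (suc n) + geomSum k f m t)) (ℕP.m∸n+n≡m m≤n) ⟨
  - G - - (f (suc n) + geomSum k f m (n ∸ m ℕ.+ m))
    ≡⟨ cong (λ t → - G - - (f (suc n) + t)) (geomSum-stable k f m 1≤k (n ∸ m)) ⟩
  - G - - (f (suc n) + G)
    ≡⟨ cancel (f (suc n)) G ⟩
  f (suc n) ∎
  where
  k≤1+n : k ≤ suc n
  k≤1+n = ℕP.≮⇒≥ n≮k
  m : ℕ
  m = suc n ∸ k
  G : ℤ
  G = geomSum k f m m
  m≤n : m ≤ n
  m≤n = ℕP.≤-pred (ℕP.∸-monoʳ-< 1≤k k≤1+n)
  cancel : ∀ a b → - b - - (a + b) ≡ a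
  cancel = solve-∀

Fn : Set
Fn = ℤ → ℤ

lift : Fn → Series
lift G n = G (+ n)

Vanishes : Fn → Set
Vanishes G = ∀ n → G -[1+ n ] ≡ + 0

δ : Fn
δ (+ n)    = one n
δ -[1+ _ ] = + 0

δ-scale : ∀ u n → .{{NonZero n}} → δ (u * + n) ≡ δ u
δ-scale (+ 0)     (suc n) = refl
δ-scale (+ suc k) (suc n) = refl
δ-scale -[1+ k ]  (suc n) = refl

δ-nonzero : ∀ {m} → m ≢ + 0 → δ m ≡ + 0
δ-nonzero {+ 0}     m≢0 = ⊥-elim (m≢0 refl)
δ-nonzero {+ suc _} _   = refl
δ-nonzero { -[1+ _ ]} _ = refl

-- The backward difference Δₖ G (m) = G (m − k) − G (m): on coefficients it is
-- multiplication by zᵏ − 1.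
Δ : ℕ → Fn → Fn
Δ k G m = G (m - + k) - G m

Δ-vanishes : ∀ k {G} → Vanishes G → Vanishes (Δ k G)
Δ-vanishes zero    vG n = cong₂ _-_ (vG n) (vG n)
Δ-vanishes (suc k) vG n = cong₂ _-_ (vG (suc (n ℕ.+ k))) (vG n)

Δ-cong : ∀ k {G H} → G ≗ H → Δ k G ≗ Δ k H
Δ-cong k eq m = cong₂ _-_ (eq _) (eq m)

Δ-comm : ∀ j k G → Δ j (Δ k G) ≗ Δ k (Δ j G)
Δ-comm j k G m = begin
  (G (m - + j - + k) - G (m - + j)) - (G (m - + k) - G m)
    ≡⟨ cong (λ t → (G t - G (m - + j)) - (G (m - + k) - G m)) (swap m (+ j) (+ k)) ⟩
  (G (m - + k - + j) - G (m - + j)) - (G (m - + k) - G m)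
    ≡⟨ interchange (G (m - + k - + j)) (G (m - + j)) (G (m - + k)) (G m) ⟩
  (G (m - + k - + j) - G (m - + k)) - (G (m - + j) - G m) ∎
  where
  swap : ∀ a b c → a - b - c ≡ a - c - b
  swap = solve-∀
  interchange : ∀ a b c d → (a - b) - (c - d) ≡ (a - c) - (b - d)
  interchange = solve-∀

mulZk-1-lift : ∀ k {G} → Vanishes G → mulZk-1 k (lift G) ≐ lift (Δ k G)
mulZk-1-lift k {G} vG n with n ℕ.<? k
... | no n≮k = cong (_- G (+ n)) (begin
  shift k (lift G) n  ≡⟨ shift-above k (lift G) k≤n ⟩
  G (+ (n ∸ k))       ≡⟨ cong G (ℤP.⊖-≥ k≤n) ⟨
  G (n ℤ.⊖ k)         ≡⟨ cong G (ℤP.m-n≡m⊖n n k) ⟨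
  G (+ n - + k)       ∎)
  where
  k≤n : k ≤ n
  k≤n = ℕP.≮⇒≥ n≮k
... | yes n<k = cong (_- G (+ n)) (begin
  shift k (lift G) n   ≡⟨ shift-below k (lift G) n<k ⟩
  + 0                  ≡⟨ vanishes-below (k ∸ n) (ℕP.m<n⇒0<n∸m n<k) ⟨
  G (- + (k ∸ n))      ≡⟨ cong G (ℤP.⊖-< n<k) ⟨
  G (n ℤ.⊖ k)          ≡⟨ cong G (ℤP.m-n≡m⊖n n k) ⟨
  G (+ n - + k)        ∎)
  where
  vanishes-below : ∀ t → 0 < t → G (- + t) ≡ + 0
  vanishes-below (suc t) _ = vG t

Δs : List ℕ → Fn → Fn
Δs ks G = foldr Δ G ks

mulsZk-1 : List ℕ → Series → Series
mulsZk-1 ks f = foldr mulZk-1 f ks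

-- Divides by the factors in list order, the first one innermost.
divsZk-1 : List ℕ → Series → Series
divsZk-1 ks f = foldl (λ g k → divZk-1 k g) f ks

Δs-cong : ∀ ks {G H} → G ≗ H → Δs ks G ≗ Δs ks H
Δs-cong []       eq = eq
Δs-cong (k ∷ ks) eq = Δ-cong k (Δs-cong ks eq)

Δs-vanishes : ∀ ks {G} → Vanishes G → Vanishes (Δs ks G)
Δs-vanishes []       vG = vG
Δs-vanishes (k ∷ ks) {G} vG = Δ-vanishes k {Δs ks G} (Δs-vanishes ks vG)

Δ-Δs-comm : ∀ k ls G → Δ k (Δs ls G) ≗ Δs ls (Δ k G)
Δ-Δs-comm k []       G m = refl
Δ-Δs-comm k (l ∷ ls) G m =
  trans (Δ-comm k l (Δs ls G) m) (Δ-cong l (Δ-Δs-comm k ls G) m)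

Δs-comm : ∀ ks ls G → Δs ks (Δs ls G) ≗ Δs ls (Δs ks G)
Δs-comm []       ls G m = refl
Δs-comm (k ∷ ks) ls G m =
  trans (Δ-cong k (Δs-comm ks ls G) m) (Δ-Δs-comm k ls (Δs ks G) m)

mulsZk-1-cong : ∀ ks {f g} → f ≐ g → mulsZk-1 ks f ≐ mulsZk-1 ks g
mulsZk-1-cong []       eq = eq
mulsZk-1-cong (k ∷ ks) eq = mulZk-1-cong k (mulsZk-1-cong ks eq)

mulsZk-1-lift : ∀ ks {G} → Vanishes G → mulsZk-1 ks (lift G) ≐ lift (Δs ks G)
mulsZk-1-lift []       vG n = refl
mulsZk-1-lift (k ∷ ks) {G} vG n =
  trans (mulZk-1-cong k (mulsZk-1-lift ks {G} vG) n)
        (mulZk-1-lift k {Δs ks G} (Δs-vanishes ks {G} vG) n)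

mulsZk-1-cancel : ∀ ks {f g} → All (1 ≤_) ks → mulsZk-1 ks f ≐ mulsZk-1 ks g → f ≐ g
mulsZk-1-cancel []       []           eq = eq
mulsZk-1-cancel (k ∷ ks) (1≤k ∷ pos) eq = mulsZk-1-cancel ks pos (mulZk-1-cancel k 1≤k eq)

mulsZk-1-divsZk-1 : ∀ ks f → All (1 ≤_) ks → mulsZk-1 ks (divsZk-1 ks f) ≐ f
mulsZk-1-divsZk-1 []       f []           n = refl
mulsZk-1-divsZk-1 (k ∷ ks) f (1≤k ∷ pos) n =
  trans (mulZk-1-cong k (mulsZk-1-divsZk-1 ks (divZk-1 k f) pos) n) (mulZk-1-divZk-1 k f 1≤k n)

quotient-lift : ∀ ds ns {H} → All (1 ≤_) ds → Vanishes H → Δs ds H ≗ Δs ns δ →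
                divsZk-1 ds (mulsZk-1 ns one) ≐ lift H
quotient-lift ds ns {H} pos vH eq = mulsZk-1-cancel ds pos λ n → begin
  mulsZk-1 ds (divsZk-1 ds (mulsZk-1 ns one)) n ≡⟨ mulsZk-1-divsZk-1 ds _ pos n ⟩
  mulsZk-1 ns (lift δ) n                        ≡⟨ mulsZk-1-lift ns {δ} δ-vanishes n ⟩
  Δs ns δ (+ n)                                 ≡⟨ eq (+ n) ⟨
  Δs ds H (+ n)                                 ≡⟨ mulsZk-1-lift ds {H} vH n ⟨
  mulsZk-1 ds (lift H) n                        ∎
  where
  δ-vanishes : Vanishes δ
  δ-vanishes n = refl

ramp : ℤ → ℤ
ramp (+ n)    = + n
ramp -[1+ _ ] = + 0

Cube : Set → Set
Cube A = Bool → Bool → Bool → A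

Δ³ : Cube ℤ → ℤ
Δ³ c = ((c true  true  true - c true  true  false) - (c true  false true - c true  false false))
     - ((c false true  true - c false true  false) - (c false false true - c false false false))

Δ³-cong : ∀ {c d : Cube ℤ} → (∀ i j k → c i j k ≡ d i j k) → Δ³ c ≡ Δ³ d
Δ³-cong eq =
  cong₂ _-_ (cong₂ _-_ (cong₂ _-_ (eq _ _ _) (eq _ _ _)) (cong₂ _-_ (eq _ _ _) (eq _ _ _)))
            (cong₂ _-_ (cong₂ _-_ (eq _ _ _) (eq _ _ _)) (cong₂ _-_ (eq _ _ _) (eq _ _ _)))

Δ³-translate : ∀ (c : Cube ℤ) e → Δ³ (λ i j k → c i j k + e) ≡ Δ³ c
Δ³-translate c e =
  translate (c true true true) (c true true false) (c true false true) (c true false false)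
            (c false true true) (c false true false) (c false false true) (c false false false) e
  where
  translate : ∀ a b c d e f g h t →
    (((a + t) - (b + t)) - ((c + t) - (d + t))) - (((e + t) - (f + t)) - ((g + t) - (h + t)))
    ≡ ((a - b) - (c - d)) - ((e - f) - (g - h))
  translate = solve-∀

clamp : ℤ → ℤ
clamp (+ 0)                      = + 0
clamp (+ 1)                      = + 1
clamp (+ 2)                      = + 2
clamp (+ suc (suc (suc _)))      = + 3
clamp -[1+ 0 ]                   = -[1+ 0 ]
clamp -[1+ 1 ]                   = -[1+ 1 ]
clamp -[1+ suc (suc _) ]         = -[1+ 2 ]

excess : ℤ → ℤ
excess L = ramp (L - + 3)

inRange : ℤ → Bool
inRange C = (-[1+ 2 ] ℤ.≤ᵇ C) ∧ (C ℤ.≤ᵇ + 3)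

-- For an offset C ∈ [−3, 3] the ramp L ↦ ramp (L − C) is 0 left of the
-- window and linear right of it, so only clamp L and the excess matter.
ramp-window : ∀ C → T (inRange C) → ∀ L → ramp (L - C) ≡ ramp (clamp L - C) + excess L
ramp-window C ok (+ 0)                 = sym (ℤP.+-identityʳ _)
ramp-window C ok (+ 1)                 = sym (ℤP.+-identityʳ _)
ramp-window C ok (+ 2)                 = sym (ℤP.+-identityʳ _)
ramp-window C ok (+ suc (suc (suc t))) = begin
  ramp (+ 3 + + t - C)   ≡⟨ cong ramp (regroup (+ 3) (+ t) C) ⟩
  ramp (+ 3 - C + + t)   ≡⟨ linear C ok ⟩
  ramp (+ 3 - C) + + t   ∎
  where
  regroup : ∀ a b c → a + b - c ≡ a - c + b
  regroup = solve-∀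
  -- (offsets outside [−3, 3] are excluded by the empty type T false)
  linear : ∀ C → T (inRange C) → ramp (+ 3 - C + + t) ≡ ramp (+ 3 - C) + + t
  linear (+ 0)                          _ = refl
  linear (+ 1)                          _ = refl
  linear (+ 2)                          _ = refl
  linear (+ 3)                          _ = refl
  linear -[1+ 0 ]                       _ = refl
  linear -[1+ 1 ]                       _ = refl
  linear -[1+ 2 ]                       _ = refl
ramp-window C ok -[1+ 0 ]              = sym (ℤP.+-identityʳ _)
ramp-window C ok -[1+ 1 ]              = sym (ℤP.+-identityʳ _)
ramp-window C ok -[1+ suc (suc t) ]    = zero-left C ok
  where
  zero-left : ∀ C → T (inRange C) → ramp (-[1+ suc (suc t) ] - C) ≡ ramp (-[1+ 2 ] - C) + + 0
  zero-left (+ 0)                          _ = refl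
  zero-left (+ 1)                          _ = refl
  zero-left (+ 2)                          _ = refl
  zero-left (+ 3)                          _ = refl
  zero-left -[1+ 0 ]                       _ = refl
  zero-left -[1+ 1 ]                       _ = refl
  zero-left -[1+ 2 ]                       _ = zero-at-minus-three t
    where
    zero-at-minus-three : ∀ t → ramp (-[1+ suc (suc t) ] - -[1+ 2 ]) ≡ + 0
    zero-at-minus-three zero    = refl
    zero-at-minus-three (suc t) = refl

ramps : ℤ → Cube ℤ → Cube ℤ
ramps L C i j k = ramp (L - C i j k)

Δ³-window : ∀ C → (∀ i j k → T (inRange (C i j k))) → ∀ L →
            Δ³ (ramps L C) ≡ Δ³ (ramps (clamp L) C)
Δ³-window C ok L = begin
  Δ³ (ramps L C)                                     ≡⟨ Δ³-cong (λ i j k → ramp-window (C i j k) (ok i j k) L) ⟩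
  Δ³ (λ i j k → ramps (clamp L) C i j k + excess L)  ≡⟨ Δ³-translate (ramps (clamp L) C) (excess L) ⟩
  Δ³ (ramps (clamp L) C)                             ∎

∧-fst : ∀ a {b} → T (a ∧ b) → T a
∧-fst true _ = _

∧-snd : ∀ a {b} → T (a ∧ b) → T b
∧-snd true t = t

⇒-elim : ∀ a {b} → T (not a ∨ b) → T a → T b
⇒-elim true t _ = t

allBool : (Bool → Bool) → Bool
allBool f = f false ∧ f true

allBool-sound : ∀ f → T (allBool f) → ∀ b → T (f b)
allBool-sound f t false = ∧-fst (f false) t
allBool-sound f t true  = ∧-snd (f false) t

allVertices : Cube Bool → Bool
allVertices f = allBool λ i → allBool λ j → allBool λ k → f i j k

allVertices-sound : ∀ f → T (allVertices f) → ∀ i j k → T (f i j k)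
allVertices-sound f t i j k =
  allBool-sound (f i j) (allBool-sound (λ j → allBool (f i j))
    (allBool-sound (λ i → allBool λ j → allBool (f i j)) t i) j) k

window : List ℤ
window = -[1+ 2 ] ∷ -[1+ 1 ] ∷ -[1+ 0 ] ∷ + 0 ∷ + 1 ∷ + 2 ∷ + 3 ∷ []

allWindow : (ℤ → Bool) → Bool
allWindow f = all f window

allWindow-sound : ∀ f → T (allWindow f) → ∀ L → T (f (clamp L))
allWindow-sound f t L = at-clamp L (all⁺ f window t)
  where
  at-clamp : ∀ L → All (T ∘ f) window → T (f (clamp L))
  at-clamp -[1+ suc (suc _) ]    (m3 ∷ _)                           = m3
  at-clamp -[1+ 1 ]              (_ ∷ m2 ∷ _)                       = m2
  at-clamp -[1+ 0 ]              (_ ∷ _ ∷ m1 ∷ _)                   = m1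
  at-clamp (+ 0)                 (_ ∷ _ ∷ _ ∷ z ∷ _)                = z
  at-clamp (+ 1)                 (_ ∷ _ ∷ _ ∷ _ ∷ p1 ∷ _)           = p1
  at-clamp (+ 2)                 (_ ∷ _ ∷ _ ∷ _ ∷ _ ∷ p2 ∷ _)       = p2
  at-clamp (+ suc (suc (suc _))) (_ ∷ _ ∷ _ ∷ _ ∷ _ ∷ _ ∷ p3 ∷ _)   = p3

β : Bool → ℤ
β true  = + 1
β false = + 0

-- The decrease of the top coordinate u when an amount with top coordinate du
-- is subtracted and the three lower digits borrow according to bx, by, bv.
carryOf : ℤ → Bool → Bool → Bool → ℤ
carryOf du bx by bv = du + β bx + β by + β bv

when : Bool → ℤ → ℤ
when b c = if b then c else + 0

-- Borrow pattern of a digit under two subtractions: whether subtracting the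
-- first amount borrows, whether subtracting the second one borrows, and
-- whether subtracting the second one after the first borrows.
Borrows : Set
Borrows = Bool × Bool × Bool

-- Without a first borrow the digit only got smaller, after a first borrow
-- it only got larger; this rules out two of the eight patterns.
consistent : Borrows → Bool
consistent (b₁ , b₂ , b₁₂) = if b₁ then not b₁₂ ∨ b₂ else not b₂ ∨ b₁₂

allBorrows : (Borrows → Bool) → Bool
allBorrows f = allBool λ b₁ → allBool λ b₂ → allBool λ b₁₂ → f (b₁ , b₂ , b₁₂)

allBorrows-sound : ∀ f → T (allBorrows f) → ∀ b → T (f b)
allBorrows-sound f t (b₁ , b₂ , b₁₂) =
  allBool-sound (λ b₁₂ → f (b₁ , b₂ , b₁₂)) (allBool-sound (λ b₂ → allBool λ b₁₂ → f (b₁ , b₂ , b₁₂))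
    (allBool-sound (λ b₁ → allBool λ b₂ → allBool λ b₁₂ → f (b₁ , b₂ , b₁₂)) t b₁) b₂) b₁₂

-- Total decrease of u at the vertex (i, j, k) of the cube spanned by
-- subtracting r, then q, then p, where the digits of p, q, r are
-- (0, y_p, v_p, −1), (x_q, 0, v_q, −1), (x_r, y_r, 0, −1); the borrow
-- patterns are those of the x-digit (by x_r, x_q), the y-digit (by y_r, y_p)
-- and the v-digit (by v_q, v_p).
cubeCarry : Borrows → Borrows → Borrows → Cube ℤ
cubeCarry (a₁ , a₂ , a₁₂) (b₁ , b₂ , b₁₂) (c₁ , c₂ , c₁₂) i j k =
    when i (carryOf -[1+ 0 ] a₁ b₁ false)
  + when j (carryOf -[1+ 0 ] (if i then a₁₂ else a₂) false c₁)
  + when k (carryOf -[1+ 0 ] false (if i then b₁₂ else b₂) (if j then c₁₂ else c₂))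

allBorrows³ : (Borrows → Borrows → Borrows → Bool) → Bool
allBorrows³ f = allBorrows λ A → allBorrows λ B → allBorrows λ C → f A B C

allBorrows³-sound : ∀ f → T (allBorrows³ f) → ∀ A B C → T (f A B C)
allBorrows³-sound f t A B C =
  allBorrows-sound (f A B) (allBorrows-sound (λ B → allBorrows (f A B))
    (allBorrows-sound (λ A → allBorrows λ B → allBorrows (f A B)) t A) B) C

∧-intro : ∀ {a b} → T a → T b → T (a ∧ b)
∧-intro {true} _ t = t

offsetsInRange : Cube ℤ → Bool
offsetsInRange C = allVertices (λ i j k → inRange (C i j k))

offsetsInRange-sound : ∀ C → T (offsetsInRange C) → ∀ i j k → T (inRange (C i j k))
offsetsInRange-sound C = allVertices-sound (λ i j k → inRange (C i j k))

boundedOnWindow : Cube ℤ → Bool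
boundedOnWindow C = allWindow (λ L → ∣ Δ³ (ramps L C) ∣ ℕ.≤ᵇ 1)

cubeGood : Borrows → Borrows → Borrows → Bool
cubeGood A B C = offsetsInRange (cubeCarry A B C) ∧ boundedOnWindow (cubeCarry A B C)

cubeCheck : T (allBorrows³ λ A B C → not (consistent A ∧ consistent B ∧ consistent C) ∨ cubeGood A B C)
cubeCheck = _

cube-bound : ∀ A B C → T (consistent A) → T (consistent B) → T (consistent C) →
             ∀ L → ∣ Δ³ (ramps L (cubeCarry A B C)) ∣ ≤ 1
cube-bound A B C okA okB okC L =
  subst (λ t → ∣ t ∣ ≤ 1) (sym (Δ³-window carries (offsetsInRange-sound carries (∧-fst _ good)) L))
        (ℕP.≤ᵇ⇒≤ _ 1 (allWindow-sound (λ L → ∣ Δ³ (ramps L carries) ∣ ℕ.≤ᵇ 1)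
                                        (∧-snd (offsetsInRange carries) good) L))
  where
  carries : Cube ℤ
  carries = cubeCarry A B C
  good : T (cubeGood A B C)
  good = ⇒-elim (consistent A ∧ consistent B ∧ consistent C)
    (allBorrows³-sound (λ A B C → not (consistent A ∧ consistent B ∧ consistent C) ∨ cubeGood A B C)
                       cubeCheck A B C)
    (∧-intro okA (∧-intro okB okC))

-- Total decrease of u at the vertex (i, j, k) of the cube spanned by
-- subtracting qr, rp and pq, whose digits are (1,0,0,0), (0,1,0,0), (0,0,1,0);
-- the flags (a, b, c) say whether the digits x, y, v are 0.
midCarry : Bool × Bool × Bool → Cube ℤ
midCarry (a , b , c) i j k =
    when i (carryOf (+ 0) a false false)
  + when j (carryOf (+ 0) false b false)
  + when k (carryOf (+ 0) false false c)

-- The value of Δ_{pqr} δ at a point with top coordinate L − 1, given whether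
-- all its lower digits vanish.
spike : Bool → ℤ → ℤ
spike allZero L = if allZero then δ (L - + 2) - δ (L - + 1) else + 0

spike-window : ∀ z L → spike z L ≡ spike z (clamp L)
spike-window z (+ 0)                 = refl
spike-window z (+ 1)                 = refl
spike-window z (+ 2)                 = refl
spike-window z (+ suc (suc (suc t))) = refl
spike-window z -[1+ 0 ]              = refl
spike-window z -[1+ 1 ]              = refl
spike-window z -[1+ suc (suc t) ]    = refl

spike-at : ∀ z u → when z (δ (u - + 1)) - when z (δ u) ≡ spike z (u + + 1)
spike-at true  u = cong₂ _-_ (cong δ (shift-back u)) (cong δ (shift-back′ u))
  where
  shift-back : ∀ u → u - + 1 ≡ u + + 1 - + 2
  shift-back = solve-∀
  shift-back′ : ∀ u → u ≡ u + + 1 - + 1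
  shift-back′ = solve-∀
spike-at false u = refl

allZero : Bool × Bool × Bool → Bool
allZero (a , b , c) = a ∧ b ∧ c

matchesOnWindow : Bool × Bool × Bool → Bool
matchesOnWindow abc =
  allWindow (λ L → isYes (Δ³ (ramps L (midCarry abc)) ℤ.≟ spike (allZero abc) L))

midCheck : T (allBorrows λ abc → offsetsInRange (midCarry abc) ∧ matchesOnWindow abc)
midCheck = _

mid-value : ∀ abc L → Δ³ (ramps L (midCarry abc)) ≡ spike (allZero abc) L
mid-value abc L = begin
  Δ³ (ramps L (midCarry abc))         ≡⟨ Δ³-window (midCarry abc) (offsetsInRange-sound (midCarry abc) (∧-fst (offsetsInRange (midCarry abc)) good)) L ⟩
  Δ³ (ramps (clamp L) (midCarry abc)) ≡⟨ toWitness {a? = Δ³ (ramps (clamp L) (midCarry abc)) ℤ.≟ spike (allZero abc) (clamp L)} (allWindow-sound (λ L → isYes (Δ³ (ramps L (midCarry abc)) ℤ.≟ spike (allZero abc) L))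
                                                    (∧-snd (offsetsInRange (midCarry abc)) good) L) ⟩
  spike (allZero abc) (clamp L)       ≡⟨ spike-window (allZero abc) L ⟨
  spike (allZero abc) L               ∎
  where
  good : T (offsetsInRange (midCarry abc) ∧ matchesOnWindow abc)
  good = allBorrows-sound (λ abc → offsetsInRange (midCarry abc) ∧ matchesOnWindow abc) midCheck abc

borrow : ℕ → ℕ → Bool
borrow x d = x ℕ.<ᵇ d

digitSub : ℕ → ℕ → ℕ → ℕ
digitSub N x d = if borrow x d then x ℕ.+ N ∸ d else x ∸ d

pos-∸ : ∀ {n d} → d ≤ n → + (n ∸ d) ≡ + n - + d
pos-∸ {n} {d} d≤n = trans (sym (ℤP.⊖-≥ d≤n)) (sym (ℤP.m-n≡m⊖n n d))

digitSub-< : ∀ {N x d} → x < N → d ≤ N → digitSub N x d < N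
digitSub-< {N} {x} {d} x<N d≤N = by-borrow (borrow x d) (ℕP.<ᵇ-reflects-< x d)
  where
  by-borrow : ∀ b → Reflects (x < d) b → (if b then x ℕ.+ N ∸ d else x ∸ d) < N
  -- x + N − d = x + (N − d) < d + (N − d) = N
  by-borrow true  (ofʸ x<d) =
    subst (_< N) (sym (ℕP.+-∸-assoc x d≤N))
      (ℕP.<-≤-trans (ℕP.+-monoˡ-< (N ∸ d) x<d) (ℕP.≤-reflexive (ℕP.m+[n∸m]≡n d≤N)))
  by-borrow false (ofⁿ _)   = ℕP.≤-<-trans (ℕP.m∸n≤m x d) x<N

digitSub-≡ : ∀ N x d → d ≤ N → + x - + d ≡ + digitSub N x d - β (borrow x d) * + N
digitSub-≡ N x d d≤N = by-borrow (borrow x d) (ℕP.<ᵇ-reflects-< x d)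
  where
  by-borrow : ∀ b → Reflects (x < d) b →
              + x - + d ≡ + (if b then x ℕ.+ N ∸ d else x ∸ d) - β b * + N
  by-borrow true  _         = begin
    + x - + d               ≡⟨ add-back (+ x) (+ d) (+ N) ⟩
    (+ x + + N) - + d - + 1 * + N ≡⟨ cong (λ t → t - + 1 * + N) (pos-∸ (ℕP.≤-trans d≤N (ℕP.m≤n+m N x))) ⟨
    + (x ℕ.+ N ∸ d) - + 1 * + N   ∎
    where
    add-back : ∀ x d N → x - d ≡ (x + N) - d - + 1 * N
    add-back = solve-∀
  by-borrow false (ofⁿ x≮d) = begin
    + x - + d               ≡⟨ pos-∸ (ℕP.≮⇒≥ x≮d) ⟨
    + (x ∸ d)               ≡⟨ ℤP.+-identityʳ _ ⟨
    + (x ∸ d) - + 0 * + N   ∎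

borrows-consistent : ∀ N x d₁ d₂ → d₁ ≤ N →
  T (consistent (borrow x d₁ , borrow x d₂ , borrow (digitSub N x d₁) d₂))
borrows-consistent N x d₁ d₂ d₁≤N =
  by-borrows (borrow x d₁) (borrow x d₂) (borrow (digitSub N x d₁) d₂)
             (ℕP.<ᵇ-reflects-< x d₁) (ℕP.<ᵇ-reflects-< x d₂) (ℕP.<ᵇ-reflects-< (digitSub N x d₁) d₂)
  where
  by-borrows : ∀ b₁ b₂ b₁₂ → Reflects (x < d₁) b₁ → Reflects (x < d₂) b₂ →
               Reflects ((if b₁ then x ℕ.+ N ∸ d₁ else x ∸ d₁) < d₂) b₁₂ →
               T (consistent (b₁ , b₂ , b₁₂))
  by-borrows true  true  true  _ _ _ = _
  by-borrows true  true  false _ _ _ = _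
  by-borrows true  false false _ _ _ = _
  by-borrows true  false true  (ofʸ x<d₁) (ofⁿ x≮d₂) (ofʸ below) =
    x≮d₂ (ℕP.≤-<-trans (ℕP.≤-trans (ℕP.m≤m+n x (N ∸ d₁)) (ℕP.≤-reflexive (sym (ℕP.+-∸-assoc x d₁≤N)))) below)
  by-borrows false false _     _ _ _ = _
  by-borrows false true  true  _ _ _ = _
  by-borrows false true  false _ (ofʸ x<d₂) (ofⁿ not-below) =
    not-below (ℕP.≤-<-trans (ℕP.m∸n≤m x d₁) x<d₂)

lift-identity : ∀ y b x a → 1 ℕ.+ y ℕ.* b ≡ x ℕ.* a → + 1 + + y * + b ≡ + x * + a
lift-identity y b x a eq = begin
  + 1 + + y * + b   ≡⟨ cong (λ t → + 1 + t) (ℤP.pos-* y b) ⟨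
  + (1 ℕ.+ y ℕ.* b) ≡⟨ cong +_ eq ⟩
  + (x ℕ.* a)       ≡⟨ ℤP.pos-* x a ⟩
  + x * + a         ∎

coprime-intBézout : ∀ {a b} → Coprime a b → Σ ℤ λ σ → Σ ℤ λ τ → σ * + b + τ * + a ≡ + 1
coprime-intBézout {a} {b} cop with coprime-Bézout cop
... | Bézout.+- x y eq = - + y , + x , identity
  where
  cancel : ∀ y b → - y * b + (+ 1 + y * b) ≡ + 1
  cancel = solve-∀
  identity : - + y * + b + + x * + a ≡ + 1
  identity = begin
    - + y * + b + + x * + a         ≡⟨ cong (λ t → - + y * + b + t) (lift-identity y b x a eq) ⟨
    - + y * + b + (+ 1 + + y * + b) ≡⟨ cancel (+ y) (+ b) ⟩
    + 1                             ∎
... | Bézout.-+ x y eq = + y , - + x , identity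
  where
  cancel : ∀ x a → (+ 1 + x * a) + - x * a ≡ + 1
  cancel = solve-∀
  identity : + y * + b + - + x * + a ≡ + 1
  identity = begin
    + y * + b + - + x * + a         ≡⟨ cong (λ t → t + - + x * + a) (lift-identity x a y b eq) ⟨
    (+ 1 + + x * + a) + - + x * + a ≡⟨ cancel (+ x) (+ a) ⟩
    + 1                             ∎

one-above-modulus : ∀ {n S} c → 2 ≤ n → S < n ℕ.+ n → S ≢ 1 → + S ≡ + 1 + c * + n → S ≡ n ℕ.+ 1
one-above-modulus (+ 0)             2≤n S<2n S≢1 eq = ⊥-elim (S≢1 (ℤP.+-injective eq))
one-above-modulus {n} (+ 1)         2≤n S<2n S≢1 eq =
  trans (ℤP.+-injective (trans eq (cong (λ t → + 1 + t) (ℤP.*-identityˡ (+ n))))) (ℕP.+-comm 1 n)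
one-above-modulus {n} {S} (+ suc (suc k)) 2≤n S<2n S≢1 eq =
  ⊥-elim (ℕP.<⇒≱ S<2n (ℕP.≤-trans 2n≤ (ℕP.≤-reflexive (sym S≡))))
  where
  S≡ : S ≡ 1 ℕ.+ suc (suc k) ℕ.* n
  S≡ = ℤP.+-injective (trans eq (cong (λ t → + 1 + t) (sym (ℤP.pos-* (suc (suc k)) n))))
  2n≤ : n ℕ.+ n ≤ 1 ℕ.+ suc (suc k) ℕ.* n
  2n≤ = ℕP.≤-trans (ℕP.+-monoʳ-≤ n (ℕP.m≤m+n n (k ℕ.* n))) (ℕP.n≤1+n _)
one-above-modulus {n} {S} -[1+ k ]  2≤n S<2n S≢1 eq =
  ⊥-elim (ℕP.<⇒≱ 2≤n (ℕP.≤-trans (ℕP.m≤m+n n (k ℕ.* n)) (ℕP.≤-trans (ℕP.m≤n+m _ S) (ℕP.≤-reflexive sum≡1))))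
  where
  move : ∀ S c n → S ≡ + 1 + c * n → S + (- c) * n ≡ + 1
  move S c n refl = cancel c n
    where
    cancel : ∀ c n → + 1 + c * n + (- c) * n ≡ + 1
    cancel = solve-∀
  sum≡1 : S ℕ.+ suc k ℕ.* n ≡ 1
  sum≡1 = ℤP.+-injective (begin
    + (S ℕ.+ suc k ℕ.* n)    ≡⟨ ℤP.pos-+ S (suc k ℕ.* n) ⟩
    + S + + (suc k ℕ.* n)    ≡⟨ cong (λ t → + S + t) (ℤP.pos-* (suc k) n) ⟩
    + S + - -[1+ k ] * + n   ≡⟨ move (+ S) -[1+ k ] (+ n) eq ⟩
    + 1                      ∎)

not-one : ∀ {a b} s t → 2 ≤ a → 2 ≤ b → s ℕ.* b ℕ.+ t ℕ.* a ≢ 1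
not-one {a} {b} (suc s) t       2≤a 2≤b eq =
  ℕP.<⇒≱ 2≤b (ℕP.≤-trans (ℕP.m≤m+n b (s ℕ.* b)) (ℕP.≤-trans (ℕP.m≤m+n _ (t ℕ.* a)) (ℕP.≤-reflexive eq)))
not-one         zero    zero    2≤a 2≤b ()
not-one {a} {b} zero    (suc t) 2≤a 2≤b eq =
  ℕP.<⇒≱ 2≤a (ℕP.≤-trans (ℕP.m≤m+n a (t ℕ.* a)) (ℕP.≤-reflexive eq))

record UnitDigits (a b : ℕ) : Set where
  constructor unitDigits
  field
    s t  : ℕ
    s<a  : s < a
    t<b  : t < b
    sum≡ : + s * + b + + t * + a ≡ + a * + b + + 1

-- Reduce a Bézout pair modulo a and b; the reduced sum is ≡ 1 (mod ab), lies
-- in [0, 2ab) and is not 1, so it equals ab + 1.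
unit-digits : ∀ {a b} → 2 ≤ a → 2 ≤ b → Coprime a b → UnitDigits a b
unit-digits {a} {b} 2≤a 2≤b cop with coprime-intBézout cop
... | σ , τ , bézout = unitDigits s t (n%ℕd<d σ a) (n%ℕd<d τ b) sum≡
  where
  instance
    a≢0 : NonZero a
    a≢0 = ℕ.>-nonZero (ℕP.<-trans (s≤s z≤n) 2≤a)
    b≢0 : NonZero b
    b≢0 = ℕ.>-nonZero (ℕP.<-trans (s≤s z≤n) 2≤b)
  s t : ℕ
  s = σ %ℕ a
  t = τ %ℕ b
  S : ℕ
  S = s ℕ.* b ℕ.+ t ℕ.* a
  pos-S : + S ≡ + s * + b + + t * + a
  pos-S = trans (ℤP.pos-+ (s ℕ.* b) (t ℕ.* a)) (cong₂ _+_ (ℤP.pos-* s b) (ℤP.pos-* t a))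
  reduce : ∀ s t ds dt A B σ τ → σ ≡ s + ds * A → τ ≡ t + dt * B → σ * B + τ * A ≡ + 1 →
           s * B + t * A ≡ + 1 + (- (ds + dt)) * (A * B)
  reduce s t ds dt A B σ τ refl refl eq = trans (regroup s t ds dt A B) (cong (λ z → z + (- (ds + dt)) * (A * B)) eq)
    where
    regroup : ∀ s t ds dt A B → s * B + t * A ≡ (s + ds * A) * B + (t + dt * B) * A + (- (ds + dt)) * (A * B)
    regroup = solve-∀
  S≡1-mod : + S ≡ + 1 + (- (σ /ℕ a + τ /ℕ b)) * + (a ℕ.* b)
  S≡1-mod = begin
    + S                                                 ≡⟨ pos-S ⟩
    + s * + b + + t * + a                               ≡⟨ reduce (+ s) (+ t) (σ /ℕ a) (τ /ℕ b) (+ a) (+ b) σ τ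
                                                             (a≡a%ℕn+[a/ℕn]*n σ a) (a≡a%ℕn+[a/ℕn]*n τ b) bézout ⟩
    + 1 + (- (σ /ℕ a + τ /ℕ b)) * (+ a * + b)           ≡⟨ cong (λ z → + 1 + (- (σ /ℕ a + τ /ℕ b)) * z) (ℤP.pos-* a b) ⟨
    + 1 + (- (σ /ℕ a + τ /ℕ b)) * + (a ℕ.* b)           ∎
  S<2ab : S < a ℕ.* b ℕ.+ a ℕ.* b
  S<2ab = ℕP.+-mono-< (ℕP.*-monoˡ-< b (n%ℕd<d σ a))
                      (ℕP.<-≤-trans (ℕP.*-monoˡ-< a (n%ℕd<d τ b)) (ℕP.≤-reflexive (ℕP.*-comm b a)))
  sum≡ : + s * + b + + t * + a ≡ + a * + b + + 1
  sum≡ = begin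
    + s * + b + + t * + a ≡⟨ pos-S ⟨
    + S                   ≡⟨ cong +_ (one-above-modulus (- (σ /ℕ a + τ /ℕ b)) (ℕP.≤-trans 2≤a (ℕP.m≤m*n a b)) S<2ab (not-one s t 2≤a 2≤b) S≡1-mod) ⟩
    + (a ℕ.* b ℕ.+ 1)     ≡⟨ ℤP.pos-+ (a ℕ.* b) 1 ⟩
    + (a ℕ.* b) + + 1     ≡⟨ cong (_+ + 1) (ℤP.pos-* a b) ⟩
    + a * + b + + 1       ∎

digitwise : ∀ P Q R X Y V U X′ Y′ V′ U′ X″ Y″ V″ bx by bv →
  X - X′ ≡ X″ - bx * P → Y - Y′ ≡ Y″ - by * Q → V - V′ ≡ V″ - bv * R →
  (X * (Q * R) + Y * (R * P) + V * (P * Q) + U * (P * Q * R)) -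
  (X′ * (Q * R) + Y′ * (R * P) + V′ * (P * Q) + U′ * (P * Q * R))
  ≡ X″ * (Q * R) + Y″ * (R * P) + V″ * (P * Q) + (U - (U′ + bx + by + bv)) * (P * Q * R)
digitwise P Q R X Y V U X′ Y′ V′ U′ X″ Y″ V″ bx by bv ex ey ev =
  absorb (solve-for ex) (solve-for ey) (solve-for ev)
  where
  solve-for : ∀ {A A′ B} → A - A′ ≡ B → A ≡ B + A′
  solve-for {A} {A′} refl = regroup A A′
    where
    regroup : ∀ A A′ → A ≡ A - A′ + A′
    regroup = solve-∀
  absorb : X ≡ X″ - bx * P + X′ → Y ≡ Y″ - by * Q + Y′ → V ≡ V″ - bv * R + V′ →
    (X * (Q * R) + Y * (R * P) + V * (P * Q) + U * (P * Q * R)) -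
    (X′ * (Q * R) + Y′ * (R * P) + V′ * (P * Q) + U′ * (P * Q * R))
    ≡ X″ * (Q * R) + Y″ * (R * P) + V″ * (P * Q) + (U - (U′ + bx + by + bv)) * (P * Q * R)
  absorb refl refl refl = expand P Q R X″ Y″ V″ U X′ Y′ V′ U′ bx by bv
    where
    expand : ∀ P Q R X″ Y″ V″ U X′ Y′ V′ U′ bx by bv →
      ((X″ - bx * P + X′) * (Q * R) + (Y″ - by * Q + Y′) * (R * P) + (V″ - bv * R + V′) * (P * Q) + U * (P * Q * R)) -
      (X′ * (Q * R) + Y′ * (R * P) + V′ * (P * Q) + U′ * (P * Q * R))
      ≡ X″ * (Q * R) + Y″ * (R * P) + V″ * (P * Q) + (U - (U′ + bx + by + bv)) * (P * Q * R)
    expand = solve-∀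

digit-unique : ∀ {a b c x x′} (W : ℤ) → Coprime a b → Coprime a c → x < a → x′ < a →
               (+ x - + x′) * (+ b * + c) ≡ + a * W → x ≡ x′
digit-unique {a} {b} {c} {x} {x′} W cop-ab cop-ac x<a x′<a eq =
  ℤP.+-injective (trans (regroup (+ x) (+ x′)) (cong (_+ + x′) (ℤP.∣i∣≡0⇒i≡0 {D} ∣D∣≡0)))
  where
  regroup : ∀ x x′ → x ≡ (x - x′) + x′
  regroup = solve-∀
  D : ℤ
  D = + x - + x′
  ∣D∣<a : ∣ D ∣ < a
  ∣D∣<a = ℕP.≤-<-trans (ℕP.≤-reflexive (cong ∣_∣ (ℤP.m-n≡m⊖n x x′)))
                       (ℕP.≤-<-trans (ℤP.∣m⊝n∣≤m⊔n x x′) (ℕP.⊔-lub x<a x′<a))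
  in-ℕ : ∣ D ∣ ℕ.* (b ℕ.* c) ≡ a ℕ.* ∣ W ∣
  in-ℕ = begin
    ∣ D ∣ ℕ.* (b ℕ.* c)     ≡⟨ cong (∣ D ∣ ℕ.*_) (ℤP.abs-* (+ b) (+ c)) ⟨
    ∣ D ∣ ℕ.* ∣ + b * + c ∣ ≡⟨ ℤP.abs-* D (+ b * + c) ⟨
    ∣ D * (+ b * + c) ∣     ≡⟨ cong ∣_∣ eq ⟩
    ∣ + a * W ∣             ≡⟨ ℤP.abs-* (+ a) W ⟩
    a ℕ.* ∣ W ∣             ∎
  a∣bcD : a ∣ b ℕ.* (c ℕ.* ∣ D ∣)
  a∣bcD = divides ∣ W ∣ (begin
    b ℕ.* (c ℕ.* ∣ D ∣) ≡⟨ ℕP.*-assoc b c ∣ D ∣ ⟨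
    b ℕ.* c ℕ.* ∣ D ∣   ≡⟨ ℕP.*-comm (b ℕ.* c) ∣ D ∣ ⟩
    ∣ D ∣ ℕ.* (b ℕ.* c) ≡⟨ in-ℕ ⟩
    a ℕ.* ∣ W ∣         ≡⟨ ℕP.*-comm a ∣ W ∣ ⟩
    ∣ W ∣ ℕ.* a         ∎)
  small-multiple : ∀ d → a ∣ d → d < a → d ≡ 0
  small-multiple zero    _   _   = refl
  small-multiple (suc d) a∣d d<a = ⊥-elim (ℕP.<⇒≱ d<a (∣⇒≤ a∣d))
  ∣D∣≡0 : ∣ D ∣ ≡ 0
  ∣D∣≡0 = small-multiple ∣ D ∣ (coprime-divisor cop-ac (coprime-divisor cop-ab a∣bcD)) ∣D∣<a

module Representation (p q r : ℕ) (2≤p : 2 ≤ p) (2≤q : 2 ≤ q) (2≤r : 2 ≤ r)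
                      (cop-pq : Coprime p q) (cop-qr : Coprime q r) (cop-rp : Coprime r p) where

  P Q R : ℤ
  P = + p
  Q = + q
  R = + r

  φ : ℤ → ℤ → ℤ → ℤ → ℤ
  φ X Y V U = X * (Q * R) + Y * (R * P) + V * (P * Q) + U * (P * Q * R)

  record Rep (m : ℤ) : Set where
    constructor rep
    field
      x y v : ℕ
      u     : ℤ
      x<p   : x < p
      y<q   : y < q
      v<r   : v < r
      m≡φ   : m ≡ φ (+ x) (+ y) (+ v) u

  open Rep public

  carry : ∀ {m d} → Rep m → Rep d → ℤ
  carry A D = carryOf (u D) (borrow (x A) (x D)) (borrow (y A) (y D)) (borrow (v A) (v D))

  subRep : ∀ {m d} → Rep m → Rep d → Rep (m - d)
  subRep {m} {d} A D =
    rep (digitSub p (x A) (x D)) (digitSub q (y A) (y D)) (digitSub r (v A) (v D)) (u A - carry A D)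
        (digitSub-< (x<p A) (ℕP.<⇒≤ (x<p D))) (digitSub-< (y<q A) (ℕP.<⇒≤ (y<q D)))
        (digitSub-< (v<r A) (ℕP.<⇒≤ (v<r D)))
        (trans (cong₂ _-_ (m≡φ A) (m≡φ D))
               (digitwise P Q R (+ x A) (+ y A) (+ v A) (u A) (+ x D) (+ y D) (+ v D) (u D)
                          (+ digitSub p (x A) (x D)) (+ digitSub q (y A) (y D)) (+ digitSub r (v A) (v D))
                          (β (borrow (x A) (x D))) (β (borrow (y A) (y D))) (β (borrow (v A) (v D)))
                          (digitSub-≡ p (x A) (x D) (ℕP.<⇒≤ (x<p D)))
                          (digitSub-≡ q (y A) (y D) (ℕP.<⇒≤ (y<q D)))
                          (digitSub-≡ r (v A) (v D) (ℕP.<⇒≤ (v<r D)))))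

  instance
    p≢0 : NonZero p
    p≢0 = ℕ.>-nonZero (ℕP.<-trans (s≤s z≤n) 2≤p)
    q≢0 : NonZero q
    q≢0 = ℕ.>-nonZero (ℕP.<-trans (s≤s z≤n) 2≤q)
    r≢0 : NonZero r
    r≢0 = ℕ.>-nonZero (ℕP.<-trans (s≤s z≤n) 2≤r)

  pos-pqr : + (p ℕ.* q ℕ.* r) ≡ P * Q * R
  pos-pqr = trans (ℤP.pos-* (p ℕ.* q) r) (cong (_* R) (ℤP.pos-* p q))

  rep-0 : Rep (+ 0)
  rep-0 = rep 0 0 0 (+ 0) (ℕ.>-nonZero⁻¹ p) (ℕ.>-nonZero⁻¹ q) (ℕ.>-nonZero⁻¹ r) (sym (value P Q R))
    where
    value : ∀ P Q R → + 0 * (Q * R) + + 0 * (R * P) + + 0 * (P * Q) + + 0 * (P * Q * R) ≡ + 0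
    value = solve-∀

  rep-qr : Rep (+ (q ℕ.* r))
  rep-qr = rep 1 0 0 (+ 0) 2≤p (ℕ.>-nonZero⁻¹ q) (ℕ.>-nonZero⁻¹ r) (trans (ℤP.pos-* q r) (sym (value P Q R)))
    where
    value : ∀ P Q R → + 1 * (Q * R) + + 0 * (R * P) + + 0 * (P * Q) + + 0 * (P * Q * R) ≡ Q * R
    value = solve-∀

  rep-rp : Rep (+ (r ℕ.* p))
  rep-rp = rep 0 1 0 (+ 0) (ℕ.>-nonZero⁻¹ p) 2≤q (ℕ.>-nonZero⁻¹ r) (trans (ℤP.pos-* r p) (sym (value P Q R)))
    where
    value : ∀ P Q R → + 0 * (Q * R) + + 1 * (R * P) + + 0 * (P * Q) + + 0 * (P * Q * R) ≡ R * P
    value = solve-∀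

  rep-pq : Rep (+ (p ℕ.* q))
  rep-pq = rep 0 0 1 (+ 0) (ℕ.>-nonZero⁻¹ p) (ℕ.>-nonZero⁻¹ q) 2≤r (trans (ℤP.pos-* p q) (sym (value P Q R)))
    where
    value : ∀ P Q R → + 0 * (Q * R) + + 0 * (R * P) + + 1 * (P * Q) + + 0 * (P * Q * R) ≡ P * Q
    value = solve-∀

  rep-pqr : Rep (+ (p ℕ.* q ℕ.* r))
  rep-pqr = rep 0 0 0 (+ 1) (ℕ.>-nonZero⁻¹ p) (ℕ.>-nonZero⁻¹ q) (ℕ.>-nonZero⁻¹ r) (trans pos-pqr (sym (value P Q R)))
    where
    value : ∀ P Q R → + 0 * (Q * R) + + 0 * (R * P) + + 0 * (P * Q) + + 1 * (P * Q * R) ≡ P * Q * R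
    value = solve-∀

  -- p = y_p·rp + v_p·pq − pqr, where y_p·r + v_p·q = qr + 1.
  module DigitsP = UnitDigits (unit-digits 2≤q 2≤r cop-qr)

  rep-p : Rep P
  rep-p = rep 0 DigitsP.s DigitsP.t -[1+ 0 ] (ℕ.>-nonZero⁻¹ p) DigitsP.s<a DigitsP.t<b (sym (begin
    φ (+ 0) Y V -[1+ 0 ]          ≡⟨ factor P Q R Y V ⟩
    P * ((Y * R + V * Q) - Q * R) ≡⟨ cong (λ t → P * (t - Q * R)) DigitsP.sum≡ ⟩
    P * ((Q * R + + 1) - Q * R)   ≡⟨ unit P Q R ⟩
    P                             ∎))
    where
    Y V : ℤ
    Y = + DigitsP.s
    V = + DigitsP.t
    factor : ∀ P Q R Y V → + 0 * (Q * R) + Y * (R * P) + V * (P * Q) + -[1+ 0 ] * (P * Q * R) ≡ P * ((Y * R + V * Q) - Q * R)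
    factor = solve-∀
    unit : ∀ P Q R → P * ((Q * R + + 1) - Q * R) ≡ P
    unit = solve-∀

  -- q = x_q·qr + v_q·pq − pqr, where x_q·r + v_q·p = pr + 1.
  module DigitsQ = UnitDigits (unit-digits 2≤p 2≤r (coprime-sym cop-rp))

  rep-q : Rep Q
  rep-q = rep DigitsQ.s 0 DigitsQ.t -[1+ 0 ] DigitsQ.s<a (ℕ.>-nonZero⁻¹ q) DigitsQ.t<b (sym (begin
    φ X (+ 0) V -[1+ 0 ]          ≡⟨ factor P Q R X V ⟩
    Q * ((X * R + V * P) - P * R) ≡⟨ cong (λ t → Q * (t - P * R)) DigitsQ.sum≡ ⟩
    Q * ((P * R + + 1) - P * R)   ≡⟨ unit P Q R ⟩
    Q                             ∎))
    where
    X V : ℤ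
    X = + DigitsQ.s
    V = + DigitsQ.t
    factor : ∀ P Q R X V → X * (Q * R) + + 0 * (R * P) + V * (P * Q) + -[1+ 0 ] * (P * Q * R) ≡ Q * ((X * R + V * P) - P * R)
    factor = solve-∀
    unit : ∀ P Q R → Q * ((P * R + + 1) - P * R) ≡ Q
    unit = solve-∀

  -- r = x_r·qr + y_r·rp − pqr, where x_r·q + y_r·p = pq + 1.
  module DigitsR = UnitDigits (unit-digits 2≤p 2≤q cop-pq)

  rep-r : Rep R
  rep-r = rep DigitsR.s DigitsR.t 0 -[1+ 0 ] DigitsR.s<a DigitsR.t<b (ℕ.>-nonZero⁻¹ r) (sym (begin
    φ X Y (+ 0) -[1+ 0 ]          ≡⟨ factor P Q R X Y ⟩
    R * ((X * Q + Y * P) - P * Q) ≡⟨ cong (λ t → R * (t - P * Q)) DigitsR.sum≡ ⟩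
    R * ((P * Q + + 1) - P * Q)   ≡⟨ unit P Q R ⟩
    R                             ∎))
    where
    X Y : ℤ
    X = + DigitsR.s
    Y = + DigitsR.t
    factor : ∀ P Q R X Y → X * (Q * R) + Y * (R * P) + + 0 * (P * Q) + -[1+ 0 ] * (P * Q * R) ≡ R * ((X * Q + Y * P) - P * Q)
    factor = solve-∀
    unit : ∀ P Q R → R * ((P * Q + + 1) - P * Q) ≡ R
    unit = solve-∀

  subRep-times : ∀ {m d} k → Rep m → Rep d → Rep (m - + k * d)
  subRep-times {m} {d} zero    A D = subst Rep (none m d) A
    where
    none : ∀ m d → m ≡ m - + 0 * d
    none = solve-∀
  subRep-times {m} {d} (suc k) A D = subst Rep (once-more m (+ k) d) (subRep (subRep-times k A D) D)
    where
    once-more : ∀ m k d → m - k * d - d ≡ m - (+ 1 + k) * d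
    once-more = solve-∀

  -- −1 = qr − y_p·r − v_p·q.
  rep-minus-one : Rep -[1+ 0 ]
  rep-minus-one = subst Rep minus-one (subRep-times DigitsP.t (subRep-times DigitsP.s rep-qr rep-r) rep-q)
    where
    Y V : ℤ
    Y = + DigitsP.s
    V = + DigitsP.t
    minus-one : + (q ℕ.* r) - Y * R - V * Q ≡ -[1+ 0 ]
    minus-one = begin
      + (q ℕ.* r) - Y * R - V * Q     ≡⟨ cong (λ t → t - Y * R - V * Q) (ℤP.pos-* q r) ⟩
      Q * R - Y * R - V * Q           ≡⟨ regroup Q R Y V ⟩
      Q * R - (Y * R + V * Q)         ≡⟨ cong (λ t → Q * R - t) DigitsP.sum≡ ⟩
      Q * R - (Q * R + + 1)           ≡⟨ cancel (Q * R) ⟩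
      -[1+ 0 ]                        ∎
      where
      regroup : ∀ Q R Y V → Q * R - Y * R - V * Q ≡ Q * R - (Y * R + V * Q)
      regroup = solve-∀
      cancel : ∀ t → t - (t + + 1) ≡ -[1+ 0 ]
      cancel = solve-∀

  rep-one : Rep (+ 1)
  rep-one = subRep rep-0 rep-minus-one

  repOf : ∀ m → Rep m
  repOf (+ n)    = subst Rep (up (+ n)) (subRep-times n rep-0 rep-minus-one)
    where
    up : ∀ n → + 0 - n * -[1+ 0 ] ≡ n
    up = solve-∀
  repOf -[1+ n ] = subst Rep (down (+ n)) (subRep-times n rep-minus-one rep-one)
    where
    down : ∀ n → -[1+ 0 ] - n * + 1 ≡ - (+ 1 + n)
    down = solve-∀

  -- Representations are unique: each digit is determined modulo its base by
  -- coprimality, and then the top coordinate is determined.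
  rep-unique : ∀ {m} (A B : Rep m) → x A ≡ x B × y A ≡ y B × v A ≡ v B × u A ≡ u B
  rep-unique (rep x y v u x<p y<q v<r m≡A) (rep x′ y′ v′ u′ x′<p y′<q v′<r m≡B) = same-top x≡ y≡ v≡
    where
    X Y V X′ Y′ V′ : ℤ
    X  = + x
    Y  = + y
    V  = + v
    X′ = + x′
    Y′ = + y′
    V′ = + v′
    difference-zero : φ X Y V u - φ X′ Y′ V′ u′ ≡ + 0
    difference-zero = trans (cong (_- φ X′ Y′ V′ u′) (trans (sym m≡A) m≡B)) (ℤP.+-inverseʳ (φ X′ Y′ V′ u′))
    modulo : ∀ {a c} → a ≡ c + (φ X Y V u - φ X′ Y′ V′ u′) → a ≡ c
    modulo {a} {c} eq = trans eq (trans (cong (λ t → c + t) difference-zero) (ℤP.+-identityʳ c))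
    mod-p : ∀ P Q R X Y V U X′ Y′ V′ U′ →
      (X - X′) * (Q * R) ≡ P * ((Y′ - Y) * R + (V′ - V) * Q + (U′ - U) * (Q * R)) +
        ((X * (Q * R) + Y * (R * P) + V * (P * Q) + U * (P * Q * R)) -
         (X′ * (Q * R) + Y′ * (R * P) + V′ * (P * Q) + U′ * (P * Q * R)))
    mod-p = solve-∀
    mod-q : ∀ P Q R X Y V U X′ Y′ V′ U′ →
      (Y - Y′) * (R * P) ≡ Q * ((X′ - X) * R + (V′ - V) * P + (U′ - U) * (R * P)) +
        ((X * (Q * R) + Y * (R * P) + V * (P * Q) + U * (P * Q * R)) -
         (X′ * (Q * R) + Y′ * (R * P) + V′ * (P * Q) + U′ * (P * Q * R)))
    mod-q = solve-∀
    mod-r : ∀ P Q R X Y V U X′ Y′ V′ U′ →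
      (V - V′) * (P * Q) ≡ R * ((X′ - X) * Q + (Y′ - Y) * P + (U′ - U) * (P * Q)) +
        ((X * (Q * R) + Y * (R * P) + V * (P * Q) + U * (P * Q * R)) -
         (X′ * (Q * R) + Y′ * (R * P) + V′ * (P * Q) + U′ * (P * Q * R)))
    mod-r = solve-∀
    x≡ : x ≡ x′
    x≡ = digit-unique _ cop-pq (coprime-sym cop-rp) x<p x′<p (modulo (mod-p P Q R X Y V u X′ Y′ V′ u′))
    y≡ : y ≡ y′
    y≡ = digit-unique _ cop-qr (coprime-sym cop-pq) y<q y′<q (modulo (mod-q P Q R X Y V u X′ Y′ V′ u′))
    v≡ : v ≡ v′
    v≡ = digit-unique _ cop-rp (coprime-sym cop-qr) v<r v′<r (modulo (mod-r P Q R X Y V u X′ Y′ V′ u′))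
    same-top : x ≡ x′ → y ≡ y′ → v ≡ v′ → x ≡ x′ × y ≡ y′ × v ≡ v′ × u ≡ u′
    same-top refl refl refl = refl , refl , refl , u≡
      where
      top : ∀ P Q R X Y V U U′ →
        U * (P * Q * R) ≡ U′ * (P * Q * R) +
          ((X * (Q * R) + Y * (R * P) + V * (P * Q) + U * (P * Q * R)) -
           (X * (Q * R) + Y * (R * P) + V * (P * Q) + U′ * (P * Q * R)))
      top = solve-∀
      u≡ : u ≡ u′
      u≡ = ℤP.*-cancelʳ-≡ u u′ (+ (p ℕ.* q ℕ.* r)) {{ℕP.m*n≢0 (p ℕ.* q) r {{ℕP.m*n≢0 p q}}}}
             (subst (λ t → u * t ≡ u′ * t) (sym pos-pqr) (modulo (top P Q R X Y V u u′)))

  F : Fn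
  F m = ramp (u (repOf m) + + 1)

  F-at : ∀ {m} (A : Rep m) → F m ≡ ramp (u A + + 1)
  F-at {m} A = cong (λ t → ramp (t + + 1)) (proj₂ (proj₂ (proj₂ (rep-unique (repOf m) A))))

  φ-ℕ : ∀ x y v k → φ (+ x) (+ y) (+ v) (+ k) ≡
        + (x ℕ.* (q ℕ.* r) ℕ.+ y ℕ.* (r ℕ.* p) ℕ.+ v ℕ.* (p ℕ.* q) ℕ.+ k ℕ.* (p ℕ.* q ℕ.* r))
  φ-ℕ x y v k
    rewrite sym (ℤP.pos-* q r) | sym (ℤP.pos-* r p) | sym (ℤP.pos-* p q) | sym (ℤP.pos-* (p ℕ.* q) r)
          | sym (ℤP.pos-* x (q ℕ.* r)) | sym (ℤP.pos-* y (r ℕ.* p)) | sym (ℤP.pos-* v (p ℕ.* q))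
          | sym (ℤP.pos-* k (p ℕ.* q ℕ.* r)) = refl

  -- A negative number has a negative top coordinate.
  F-vanishes : Vanishes F
  F-vanishes n = negative-top (repOf -[1+ n ])
    where
    negative-top : (A : Rep -[1+ n ]) → ramp (u A + + 1) ≡ + 0
    negative-top (rep x y v (+ k) _ _ _ eq) with trans eq (φ-ℕ x y v k)
    ... | ()
    negative-top (rep x y v -[1+ 0 ]     _ _ _ _) = refl
    negative-top (rep x y v -[1+ suc _ ] _ _ _ _) = refl

  minusIf : Bool → ℤ → ℤ → ℤ
  minusIf b d m = if b then m - d else m

  subIf : ∀ {m d} b → Rep m → Rep d → Rep (minusIf b d m)
  subIf true  A D = subRep A D
  subIf false A D = A

  u-subIf : ∀ {m d} b (A : Rep m) (D : Rep d) → u (subIf b A D) ≡ u A - when b (carry A D)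
  u-subIf true  A D = refl
  u-subIf false A D = sym (ℤP.+-identityʳ (u A))

  vertexCarry : ∀ {m d₁ d₂ d₃} → Rep m → Rep d₁ → Rep d₂ → Rep d₃ → Cube ℤ
  vertexCarry A D₁ D₂ D₃ i j k =
      when i (carry A D₁)
    + when j (carry (subIf i A D₁) D₂)
    + when k (carry (subIf j (subIf i A D₁) D₂) D₃)

  Δ³-F : ∀ {m d₁ d₂ d₃} (A : Rep m) (D₁ : Rep (+ d₁)) (D₂ : Rep (+ d₂)) (D₃ : Rep (+ d₃)) →
         Δ d₁ (Δ d₂ (Δ d₃ F)) m ≡ Δ³ (ramps (u A + + 1) (vertexCarry A D₁ D₂ D₃))
  Δ³-F {m} {d₁} {d₂} {d₃} A D₁ D₂ D₃ = Δ³-cong vertex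
    where
    vertex : ∀ i j k → F (minusIf k (+ d₃) (minusIf j (+ d₂) (minusIf i (+ d₁) m))) ≡
                       ramps (u A + + 1) (vertexCarry A D₁ D₂ D₃) i j k
    vertex i j k = begin
      F (minusIf k (+ d₃) (minusIf j (+ d₂) (minusIf i (+ d₁) m)))
        ≡⟨ F-at (subIf k (subIf j (subIf i A D₁) D₂) D₃) ⟩
      ramp (u (subIf k (subIf j (subIf i A D₁) D₂) D₃) + + 1)
        ≡⟨ cong (λ t → ramp (t + + 1)) (begin
             u (subIf k (subIf j (subIf i A D₁) D₂) D₃)
               ≡⟨ u-subIf k _ D₃ ⟩
             u (subIf j (subIf i A D₁) D₂) - c₃
               ≡⟨ cong (_- c₃) (u-subIf j _ D₂) ⟩
             u (subIf i A D₁) - c₂ - c₃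
               ≡⟨ cong (λ t → t - c₂ - c₃) (u-subIf i A D₁) ⟩
             u A - c₁ - c₂ - c₃ ∎) ⟩
      ramp (u A - c₁ - c₂ - c₃ + + 1)
        ≡⟨ cong ramp (collect (u A) c₁ c₂ c₃) ⟩
      ramp (u A + + 1 - (c₁ + c₂ + c₃)) ∎
      where
      c₁ c₂ c₃ : ℤ
      c₁ = when i (carry A D₁)
      c₂ = when j (carry (subIf i A D₁) D₂)
      c₃ = when k (carry (subIf j (subIf i A D₁) D₂) D₃)
      collect : ∀ u a b c → u - a - b - c + + 1 ≡ u + + 1 - (a + b + c)
      collect = solve-∀

  zeroFlags : ∀ {m} → Rep m → Bool × Bool × Bool
  zeroFlags A = borrow (x A) 1 , borrow (y A) 1 , borrow (v A) 1

  digits-of-0 : ∀ {m} (A : Rep m) → m ≡ + 0 → x A ≡ 0 × y A ≡ 0 × v A ≡ 0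
  digits-of-0 A refl = proj₁ same , proj₁ (proj₂ same) , proj₁ (proj₂ (proj₂ same))
    where
    same : x A ≡ 0 × y A ≡ 0 × v A ≡ 0 × u A ≡ + 0
    same = rep-unique A rep-0

  -- δ through the representation: m = 0 iff its digits and its top coordinate vanish.
  δ-rep : ∀ {m} (A : Rep m) → δ m ≡ when (allZero (zeroFlags A)) (δ (u A))
  δ-rep A@(rep (suc _) _ _ _ _ _ _ _)            = δ-nonzero λ m≡0 → case-suc (proj₁ (digits-of-0 A m≡0))
    where case-suc : ∀ {n} → suc n ≢ 0
          case-suc ()
  δ-rep A@(rep zero (suc _) _ _ _ _ _ _)         = δ-nonzero λ m≡0 → case-suc (proj₁ (proj₂ (digits-of-0 A m≡0)))
    where case-suc : ∀ {n} → suc n ≢ 0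
          case-suc ()
  δ-rep A@(rep zero zero (suc _) _ _ _ _ _)      = δ-nonzero λ m≡0 → case-suc (proj₂ (proj₂ (digits-of-0 A m≡0)))
    where case-suc : ∀ {n} → suc n ≢ 0
          case-suc ()
  δ-rep {m} (rep zero zero zero u _ _ _ m≡φ) = begin
    δ m                         ≡⟨ cong δ (trans m≡φ (multiple P Q R u)) ⟩
    δ (u * (P * Q * R))         ≡⟨ cong (λ t → δ (u * t)) pos-pqr ⟨
    δ (u * + (p ℕ.* q ℕ.* r))   ≡⟨ δ-scale u (p ℕ.* q ℕ.* r) {{ℕP.m*n≢0 (p ℕ.* q) r {{ℕP.m*n≢0 p q}}}} ⟩
    δ u                         ∎
    where
    multiple : ∀ P Q R u → + 0 * (Q * R) + + 0 * (R * P) + + 0 * (P * Q) + u * (P * Q * R) ≡ u * (P * Q * R)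
    multiple = solve-∀

  green : Δs (q ℕ.* r ∷ r ℕ.* p ∷ p ℕ.* q ∷ []) F ≗ Δ (p ℕ.* q ℕ.* r) δ
  green m = green-at (repOf m)
    where
    green-at : ∀ {m} (A : Rep m) → Δs (q ℕ.* r ∷ r ℕ.* p ∷ p ℕ.* q ∷ []) F m ≡ Δ (p ℕ.* q ℕ.* r) δ m
    green-at {m} A = begin
      Δs (q ℕ.* r ∷ r ℕ.* p ∷ p ℕ.* q ∷ []) F m          ≡⟨ Δ³-F A rep-qr rep-rp rep-pq ⟩
      Δ³ (ramps (u A + + 1) (midCarry (zeroFlags A)))   ≡⟨ mid-value (zeroFlags A) (u A + + 1) ⟩
      spike z (u A + + 1)                               ≡⟨ spike-at z (u A) ⟨
      when z (δ (u A - + 1)) - when z (δ (u A))         ≡⟨ cong₂ _-_ (δ-rep {m - + (p ℕ.* q ℕ.* r)} (subRep A rep-pqr)) (δ-rep {m} A) ⟨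
      δ (m - + (p ℕ.* q ℕ.* r)) - δ m                   ∎
      where
      z : Bool
      z = allZero (zeroFlags A)

  H : Fn
  H = Δs (r ∷ q ∷ p ∷ []) F

  H-vanishes : Vanishes H
  H-vanishes = Δs-vanishes (r ∷ q ∷ p ∷ []) {F} F-vanishes

  H-equation : Δs (q ℕ.* r ∷ r ℕ.* p ∷ p ℕ.* q ∷ []) H ≗ Δs (r ∷ q ∷ p ∷ p ℕ.* q ℕ.* r ∷ []) δ
  H-equation m =
    trans (Δs-comm (q ℕ.* r ∷ r ℕ.* p ∷ p ℕ.* q ∷ []) (r ∷ q ∷ p ∷ []) F m)
          (Δs-cong (r ∷ q ∷ p ∷ []) green m)

  -- |H m| ≤ 1: H m is the third difference of ramps along the cube spanned by
  -- subtracting r, q, p, whose borrow patterns are consistent.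
  H-bound : ∀ m → ∣ H m ∣ ≤ 1
  H-bound m = subst (λ t → ∣ t ∣ ≤ 1) (sym (Δ³-F A rep-r rep-q rep-p))
                    (cube-bound borrowsX borrowsY borrowsV
                      (borrows-consistent p (x A) (x rep-r) (x rep-q) (ℕP.<⇒≤ (x<p rep-r)))
                      (borrows-consistent q (y A) (y rep-r) (y rep-p) (ℕP.<⇒≤ (y<q rep-r)))
                      (borrows-consistent r (v A) (v rep-q) (v rep-p) (ℕP.<⇒≤ (v<r rep-q)))
                      (u A + + 1))
    where
    A : Rep m
    A = repOf m
    borrowsX borrowsY borrowsV : Borrows
    borrowsX = borrow (x A) (x rep-r) , borrow (x A) (x rep-q) , borrow (digitSub p (x A) (x rep-r)) (x rep-q)
    borrowsY = borrow (y A) (y rep-r) , borrow (y A) (y rep-p) , borrow (digitSub q (y A) (y rep-r)) (y rep-p)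
    borrowsV = borrow (v A) (v rep-q) , borrow (v A) (v rep-p) , borrow (digitSub r (v A) (v rep-q)) (v rep-p)

1≤product : ∀ {m n} → 1 ≤ m → 1 ≤ n → 1 ≤ m ℕ.* n
1≤product {suc m} {suc n} _ _ = s≤s z≤n

Qcoeff-difference : ∀ p q r {H} → 1 ≤ p → 1 ≤ q → 1 ≤ r → Vanishes H →
  Δs (q ℕ.* r ∷ r ℕ.* p ∷ p ℕ.* q ∷ []) H ≗ Δs (r ∷ q ∷ p ∷ p ℕ.* q ℕ.* r ∷ []) δ →
  mulZk-1 1 (Qcoeff p q r) ≐ lift H
Qcoeff-difference p q r {H} 1≤p 1≤q 1≤r vH eq n =
  trans (mulZk-1-divZk-1 1 _ (s≤s z≤n) n)
        (quotient-lift (q ℕ.* r ∷ r ℕ.* p ∷ p ℕ.* q ∷ []) (r ∷ q ∷ p ∷ p ℕ.* q ℕ.* r ∷ []) {H}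
                       (1≤product 1≤q 1≤r ∷ 1≤product 1≤r 1≤p ∷ 1≤product 1≤p 1≤q ∷ []) vH eq n)

backward-difference : ∀ p q r {G} → Vanishes G → mulZk-1 1 (Qcoeff p q r) ≐ lift G →
                      ∀ m → a p q r (m - + 1) - a p q r m ≡ G m
backward-difference p q r vG eq (+ n)    = trans (shifted n) (eq n)
  where
  shifted : ∀ n → a p q r (+ n - + 1) - Qcoeff p q r n ≡ mulZk-1 1 (Qcoeff p q r) n
  shifted zero    = refl
  shifted (suc n) = refl
backward-difference p q r vG eq -[1+ n ] = sym (vG n)

-- The theorem: |a_m − a_{m−1}| = |H (m)| ≤ 1 (the argument only uses p, q, r ≥ 2).
lemma2 : (p q r : ℕ) → 3 ≤ p → 3 ≤ q → 3 ≤ r →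
         Coprime p q → Coprime q r → Coprime r p →
         (m : ℤ) → ∣ a p q r m - a p q r (m - + 1) ∣ ≤ 1
lemma2 p q r 3≤p 3≤q 3≤r cop-pq cop-qr cop-rp m = ℕP.≤-trans (ℕP.≤-reflexive ∣a-difference∣) (H-bound m)
  where
  2≤p : 2 ≤ p
  2≤p = ℕP.≤-trans (ℕP.n≤1+n 2) 3≤p
  2≤q : 2 ≤ q
  2≤q = ℕP.≤-trans (ℕP.n≤1+n 2) 3≤q
  2≤r : 2 ≤ r
  2≤r = ℕP.≤-trans (ℕP.n≤1+n 2) 3≤r
  open Representation p q r 2≤p 2≤q 2≤r cop-pq cop-qr cop-rp using (H; H-vanishes; H-equation; H-bound)
  ∣a-difference∣ : ∣ a p q r m - a p q r (m - + 1) ∣ ≡ ∣ H m ∣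
  ∣a-difference∣ = trans (ℤP.∣i-j∣≡∣j-i∣ (a p q r m) (a p q r (m - + 1)))
    (cong ∣_∣ (backward-difference p q r {H} H-vanishes
                 (Qcoeff-difference p q r {H} (ℕP.<⇒≤ 2≤p) (ℕP.<⇒≤ 2≤q) (ℕP.<⇒≤ 2≤r) H-vanishes H-equation) m))
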